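{- Let $G$ be a finite directed weighted graph on nodes $\{1,\dots,n\}$ without loops with positive edge weights and adjacency matrix $A$, whose $m$ edges are labelled $1,\dots,m$. Let $L,R\in\mathbb{R}^{m\times n}$ be the source and target matrices, $Z$ the edge-weight matrix, and $W$ the weighted line-graph matrix. Then for all integers $k\ge 0$, \[ L^T\sqrt{Z}\,(W^{\circ 1/2})^k\sqrt{Z}\,R = A^{k+1}. \]
   Context: $L_{ej}=1$ if edge $e$ starts at node $j$, else $0$; $R_{ej}=1$ if edge $e$ ends at node $j$, else $0$. $Z$ is the $m\times m$ diagonal matrix with $Z_{ee}=A_{ij}$ when edge $e$ is $(i,j)$; $\sqrt{Z}$ is its entrywise square root. $W_{ef}=A_{ij}A_{jk}$ if $e=(i,j)$ and $f=(j,k)$, and $W_{ef}=0$ otherwise; $W^{\circ 1/2}$ is its elementwise square root; $(W^{\circ 1/2})^0=I$. -}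

module Defs where

open import Level using (Level; _⊔_; suc)
open import Algebra.Bundles using (CommutativeRing)
open import Data.Nat using (ℕ; zero) renaming (suc to sucℕ)
open import Data.Fin using (Fin; _≟_)
open import Data.Product using (_×_)
import Data.Product
import Data.Sum
import Data.Fin
open import Relation.Nullary using (¬_; yes; no)
open import Relation.Binary.PropositionalEquality using (_≡_)

-- A commutative ring equipped with a positivity predicate and a square-root
-- function that behaves like the real square root on nonnegative reals.
-- (ℝ with Pos x = x > 0 and the usual √ is an instance.)
record SqrtRing (c ℓ : Level) : Set (Level.suc (c ⊔ ℓ)) where
  field
    commRing : CommutativeRing c ℓ
  open CommutativeRing commRing public
  field
    Pos      : Carrier → Set ℓ
    Pos≉0    : ∀ {x} → Pos x → ¬ (x ≈ 0#)
    Pos-*    : ∀ {x y} → Pos x → Pos y → Pos (x * y)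
    sqrt     : Carrier → Carrier
    sqrt-cong : ∀ {x y} → x ≈ y → sqrt x ≈ sqrt y
    sqrt-0   : sqrt 0# ≈ 0#
    sqrt-sq  : ∀ {x} → Pos x → sqrt x * sqrt x ≈ x
    sqrt-*   : ∀ {x y} → Pos x → Pos y → sqrt (x * y) ≈ sqrt x * sqrt y

module Mat {c ℓ : Level} (S : SqrtRing c ℓ) where
  open SqrtRing S

  Matrix : ℕ → ℕ → Set c
  Matrix a b = Fin a → Fin b → Carrier

  Σ : ∀ {n} → (Fin n → Carrier) → Carrier
  Σ {zero}   f = 0#
  Σ {sucℕ n} f = f Fin.zero + Σ (λ i → f (Fin.suc i))

  _⊗_ : ∀ {a b d} → Matrix a b → Matrix b d → Matrix a d
  (M ⊗ N) i j = Σ (λ k → M i k * N k j)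

  transpose : ∀ {a b} → Matrix a b → Matrix b a
  transpose M i j = M j i

  I : ∀ {a} → Matrix a a
  I i j with i ≟ j
  ... | yes _ = 1#
  ... | no  _ = 0#

  _^_ : ∀ {a} → Matrix a a → ℕ → Matrix a a
  M ^ zero     = I
  M ^ sucℕ k   = M ⊗ (M ^ k)

  sqrtᵉ : ∀ {a b} → Matrix a b → Matrix a b
  sqrtᵉ M i j = sqrt (M i j)

  _≈ᴹ_ : ∀ {a b} → Matrix a b → Matrix a b → Set ℓ
  M ≈ᴹ N = ∀ i j → M i j ≈ N i j

  module Graph {n m : ℕ} (A : Matrix n n) (src tgt : Fin m → Fin n) where

    L : Matrix m n
    L e j with src e ≟ j
    ... | yes _ = 1#
    ... | no  _ = 0#

    R : Matrix m n
    R e j with tgt e ≟ j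
    ... | yes _ = 1#
    ... | no  _ = 0#

    Z : Matrix m m
    Z e f with e ≟ f
    ... | yes _ = A (src e) (tgt e)
    ... | no  _ = 0#

    W : Matrix m m
    W e f with tgt e ≟ src f
    ... | yes _ = A (src e) (tgt e) * A (src f) (tgt f)
    ... | no  _ = 0#

  record IsEdgeLabelling {n m : ℕ} (A : Matrix n n) (src tgt : Fin m → Fin n) : Set (c ⊔ ℓ) where
    field
      nonneg   : ∀ i j → (A i j ≈ 0#) Data.Sum.⊎ Pos (A i j)
      noLoops  : ∀ i → A i i ≈ 0#
      edgePos  : ∀ e → Pos (A (src e) (tgt e))
      injective : ∀ e f → src e ≡ src f → tgt e ≡ tgt f → e ≡ f
      surjective : ∀ i j → Pos (A i j) → Data.Product.∃ (λ e → src e ≡ i × tgt e ≡ j)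

-- Put B = Lᵀ√Z and C = √Z R, so B_ie = [e starts at i] √A_e and
-- C_ej = √A_e [e ends at j].  Then (C B)_ef = √A_e √A_f [e ends where f starts],
-- which is W^{∘1/2}_ef because √(A_e A_f) = √A_e √A_f; and (B C)_ij is the sum
-- of A_e over the edges e from i to j, which is A_ij since the edges are
-- exactly the positive entries of A, each labelled once.  The push-through identity B (C B)^k C = (B C)^(k+1) finishes.
module Submission where

open import Defs
open import Level using (Level)
open import Data.Nat using (ℕ; zero; suc)
open import Data.Fin using (Fin; _≟_; punchIn)
import Data.Fin as Fin
open import Data.Fin.Properties using (punchInᵢ≢i)
open import Data.Product using (_,_)
open import Data.Sum using (inj₁; inj₂)
open import Function using (_∘_)
open import Relation.Nullary using (yes; no)
open import Relation.Binary.PropositionalEquality as ≡ using (_≡_; _≢_)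
open import Data.Empty using (⊥-elim)
import Algebra.Properties.Semiring.Sum as SemiringSum
open import Relation.Binary.Bundles using (Setoid)

module MatrixAlgebra {c ℓ : Level} (S : SqrtRing c ℓ) where
  open SqrtRing S
  open Mat S
  open SemiringSum semiring
    using (sum; sum-cong-≋; ∑-comm; *-distribˡ-sum; *-distribʳ-sum; sum-remove; sum-replicate-zero)
  import Relation.Binary.Reasoning.Setoid as SetoidReasoning

  module ≈-Reasoning = SetoidReasoning setoid

  Σ≡sum : ∀ {k} (f : Fin k → Carrier) → Σ f ≡ sum f
  Σ≡sum {zero}  f = ≡.refl
  Σ≡sum {suc k} f = ≡.cong (f Fin.zero +_) (Σ≡sum (f ∘ Fin.suc))

  Σ²≈sum² : ∀ {a b} (f : Fin a → Fin b → Carrier) → Σ (λ i → Σ (f i)) ≈ sum (λ i → sum (f i))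
  Σ²≈sum² f =
    trans (reflexive (Σ≡sum (λ i → Σ (f i)))) (sum-cong-≋ (λ i → reflexive (Σ≡sum (f i))))

  Σ-cong : ∀ {k} {f g : Fin k → Carrier} → (∀ i → f i ≈ g i) → Σ f ≈ Σ g
  Σ-cong {f = f} {g} f≈g rewrite Σ≡sum f | Σ≡sum g = sum-cong-≋ f≈g

  Σ-comm : ∀ {a b} (f : Fin a → Fin b → Carrier) →
           Σ (λ i → Σ (λ j → f i j)) ≈ Σ (λ j → Σ (λ i → f i j))
  Σ-comm f = begin
    Σ (λ i → Σ (f i))               ≈⟨ Σ²≈sum² f ⟩
    sum (λ i → sum (f i))           ≈⟨ ∑-comm f ⟩
    sum (λ j → sum (λ i → f i j))   ≈⟨ Σ²≈sum² (λ j i → f i j) ⟨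
    Σ (λ j → Σ (λ i → f i j))       ∎
    where open ≈-Reasoning

  Σ-zero : ∀ {k} (f : Fin k → Carrier) → (∀ i → f i ≈ 0#) → Σ f ≈ 0#
  Σ-zero {k} f f≈0 = begin
    Σ f                  ≡⟨ Σ≡sum f ⟩
    sum f                ≈⟨ sum-cong-≋ {n = k} {x = f} {y = λ _ → 0#} f≈0 ⟩
    sum {k} (λ _ → 0#)   ≈⟨ sum-replicate-zero k ⟩
    0# ∎
    where open ≈-Reasoning

  Σ-*ˡ : ∀ {k} (x : Carrier) (f : Fin k → Carrier) → x * Σ f ≈ Σ (λ i → x * f i)
  Σ-*ˡ x f rewrite Σ≡sum f | Σ≡sum (λ i → x * f i) = *-distribˡ-sum x f

  Σ-*ʳ : ∀ {k} (x : Carrier) (f : Fin k → Carrier) → Σ f * x ≈ Σ (λ i → f i * x)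
  Σ-*ʳ x f rewrite Σ≡sum f | Σ≡sum (λ i → f i * x) = *-distribʳ-sum x f

  Σ-supported-at : ∀ {k} (i : Fin k) (f : Fin k → Carrier) → (∀ j → j ≢ i → f j ≈ 0#) → Σ f ≈ f i
  Σ-supported-at {suc k} i f f≈0 = begin
    Σ f                         ≡⟨ Σ≡sum f ⟩
    sum f                       ≈⟨ sum-remove f ⟩
    f i + sum (f ∘ punchIn i)   ≡⟨ ≡.cong (f i +_) (Σ≡sum (f ∘ punchIn i)) ⟨
    f i + Σ (f ∘ punchIn i)     ≈⟨ +-congˡ (Σ-zero (f ∘ punchIn i) (λ j → f≈0 _ (punchInᵢ≢i i j))) ⟩
    f i + 0#                    ≈⟨ +-identityʳ (f i) ⟩
    f i                         ∎
    where open ≈-Reasoning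

  ≈ᴹ-setoid : ℕ → ℕ → Setoid c ℓ
  ≈ᴹ-setoid a b = record
    { Carrier       = Matrix a b
    ; _≈_           = _≈ᴹ_
    ; isEquivalence = record
      { refl  = λ _ _ → refl
      ; sym   = λ M≈N i j → sym (M≈N i j)
      ; trans = λ M≈N N≈P i j → trans (M≈N i j) (N≈P i j)
      }
    }

  module ᴹ-Reasoning {a b : ℕ} = SetoidReasoning (≈ᴹ-setoid a b)

  ≈ᴹ-refl : ∀ {a b} {M : Matrix a b} → M ≈ᴹ M
  ≈ᴹ-refl _ _ = refl

  ⊗-cong : ∀ {a b d} {M M' : Matrix a b} {N N' : Matrix b d} →
           M ≈ᴹ M' → N ≈ᴹ N' → (M ⊗ N) ≈ᴹ (M' ⊗ N')
  ⊗-cong M≈M' N≈N' i j = Σ-cong (λ k → *-cong (M≈M' i k) (N≈N' k j))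

  ⊗-congˡ : ∀ {a b d} {M : Matrix a b} {N N' : Matrix b d} → N ≈ᴹ N' → (M ⊗ N) ≈ᴹ (M ⊗ N')
  ⊗-congˡ = ⊗-cong ≈ᴹ-refl

  ⊗-assoc : ∀ {a b d e} (M : Matrix a b) (N : Matrix b d) (P : Matrix d e) →
            ((M ⊗ N) ⊗ P) ≈ᴹ (M ⊗ (N ⊗ P))
  ⊗-assoc {b = b} {d} M N P i j = begin
    Σ (λ k → Σ (λ l → M i l * N l k) * P k j)
      ≈⟨ Σ-cong {d} (λ k → trans (Σ-*ʳ (P k j) (λ l → M i l * N l k))
                                 (Σ-cong {b} (λ l → *-assoc (M i l) (N l k) (P k j)))) ⟩
    Σ (λ k → Σ (λ l → M i l * (N l k * P k j)))
      ≈⟨ Σ-comm {d} {b} (λ k l → M i l * (N l k * P k j)) ⟩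
    Σ (λ l → Σ (λ k → M i l * (N l k * P k j)))
      ≈⟨ Σ-cong {b} (λ l → sym (Σ-*ˡ (M i l) (λ k → N l k * P k j))) ⟩
    Σ (λ l → M i l * Σ (λ k → N l k * P k j)) ∎
    where open ≈-Reasoning

  Diagonal : ∀ {a} → Matrix a a → Set ℓ
  Diagonal D = ∀ i j → i ≢ j → D i j ≈ 0#

  ⊗-diagonalʳ : ∀ {a b} (M : Matrix a b) {D : Matrix b b} → Diagonal D →
                ∀ i j → (M ⊗ D) i j ≈ M i j * D j j
  ⊗-diagonalʳ M D-diag i j =
    Σ-supported-at j _ (λ k k≢j → trans (*-congˡ (D-diag k j k≢j)) (zeroʳ (M i k)))

  ⊗-diagonalˡ : ∀ {a b} {D : Matrix a a} (M : Matrix a b) → Diagonal D →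
                ∀ i j → (D ⊗ M) i j ≈ D i i * M i j
  ⊗-diagonalˡ M D-diag i j =
    Σ-supported-at i _ (λ k k≢i → trans (*-congʳ (D-diag i k (k≢i ∘ ≡.sym))) (zeroˡ (M k j)))

  I-≡ : ∀ {a} {i j : Fin a} → i ≡ j → I i j ≈ 1#
  I-≡ {i = i} ≡.refl with i ≟ i
  ... | yes _   = refl
  ... | no i≢i = ⊥-elim (i≢i ≡.refl)

  I-≢ : ∀ {a} {i j : Fin a} → i ≢ j → I i j ≈ 0#
  I-≢ {i = i} {j} i≢j with i ≟ j
  ... | yes i≡j = ⊥-elim (i≢j i≡j)
  ... | no _    = refl

  I-diagonal : ∀ {a} → Diagonal (I {a})
  I-diagonal _ _ = I-≢

  ⊗-identityˡ : ∀ {a b} (M : Matrix a b) → (I ⊗ M) ≈ᴹ M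
  ⊗-identityˡ M i j =
    trans (⊗-diagonalˡ M I-diagonal i j) (trans (*-congʳ (I-≡ {i = i} ≡.refl)) (*-identityˡ (M i j)))

  ⊗-identityʳ : ∀ {a b} (M : Matrix a b) → (M ⊗ I) ≈ᴹ M
  ⊗-identityʳ M i j =
    trans (⊗-diagonalʳ M I-diagonal i j) (trans (*-congˡ (I-≡ {i = j} ≡.refl)) (*-identityʳ (M i j)))

  ^-cong : ∀ {a} {M N : Matrix a a} → M ≈ᴹ N → ∀ k → (M ^ k) ≈ᴹ (N ^ k)
  ^-cong M≈N zero    = ≈ᴹ-refl
  ^-cong M≈N (suc k) = ⊗-cong M≈N (^-cong M≈N k)

  push-through-^ : ∀ {a b} {A : Matrix a a} (B : Matrix a b) (C : Matrix b a) →
                   (B ⊗ C) ≈ᴹ A → ∀ k → (B ⊗ (((C ⊗ B) ^ k) ⊗ C)) ≈ᴹ (A ^ suc k)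
  push-through-^ {A = A} B C BC≈A zero = begin
    B ⊗ (I ⊗ C)   ≈⟨ ⊗-congˡ (⊗-identityˡ C) ⟩
    B ⊗ C         ≈⟨ BC≈A ⟩
    A             ≈⟨ ⊗-identityʳ A ⟨
    A ⊗ I         ∎
    where open ᴹ-Reasoning
  push-through-^ {A = A} B C BC≈A (suc k) = begin
    B ⊗ (((C ⊗ B) ⊗ X) ⊗ C)   ≈⟨ ⊗-congˡ (⊗-assoc (C ⊗ B) X C) ⟩
    B ⊗ ((C ⊗ B) ⊗ (X ⊗ C))   ≈⟨ ⊗-congˡ (⊗-assoc C B (X ⊗ C)) ⟩
    B ⊗ (C ⊗ (B ⊗ (X ⊗ C)))   ≈⟨ ⊗-assoc B C (B ⊗ (X ⊗ C)) ⟨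
    (B ⊗ C) ⊗ (B ⊗ (X ⊗ C))   ≈⟨ ⊗-cong BC≈A (push-through-^ B C BC≈A k) ⟩
    A ⊗ (A ^ suc k)           ∎
    where
    open ᴹ-Reasoning
    X = (C ⊗ B) ^ k

module LineGraphFactorisation {c ℓ : Level} (S : SqrtRing c ℓ) {n m : ℕ}
         (A : Mat.Matrix S n n) (src tgt : Fin m → Fin n)
         (labelling : Mat.IsEdgeLabelling S A src tgt) where
  open SqrtRing S
  open Mat S
  open Graph A src tgt
  open IsEdgeLabelling labelling
  open MatrixAlgebra S
  open ≈-Reasoning

  w : Fin m → Carrier
  w e = A (src e) (tgt e)

  √w : Fin m → Carrier
  √w e = sqrt (w e)

  √w-sq : ∀ e → √w e * √w e ≈ w e
  √w-sq e = sqrt-sq (edgePos e)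

  Lᵀ√Z : Matrix n m
  Lᵀ√Z = transpose L ⊗ sqrtᵉ Z

  √ZR : Matrix m n
  √ZR = sqrtᵉ Z ⊗ R

  L≡I : ∀ e j → L e j ≡ I (src e) j
  L≡I e j with src e ≟ j
  ... | yes _ = ≡.refl
  ... | no _  = ≡.refl

  R≡I : ∀ e j → R e j ≡ I (tgt e) j
  R≡I e j with tgt e ≟ j
  ... | yes _ = ≡.refl
  ... | no _  = ≡.refl

  L-at : ∀ {e j} → src e ≡ j → L e j ≈ 1#
  L-at {e} {j} p = trans (reflexive (L≡I e j)) (I-≡ p)

  L-off : ∀ {e j} → src e ≢ j → L e j ≈ 0#
  L-off {e} {j} p = trans (reflexive (L≡I e j)) (I-≢ p)

  R-at : ∀ {e j} → tgt e ≡ j → R e j ≈ 1#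
  R-at {e} {j} p = trans (reflexive (R≡I e j)) (I-≡ p)

  R-off : ∀ {e j} → tgt e ≢ j → R e j ≈ 0#
  R-off {e} {j} p = trans (reflexive (R≡I e j)) (I-≢ p)

  √Z-diagonal : Diagonal (sqrtᵉ Z)
  √Z-diagonal e f e≢f with e ≟ f
  ... | yes e≡f = ⊥-elim (e≢f e≡f)
  ... | no _    = sqrt-0

  √Z-on-diagonal : ∀ e → sqrtᵉ Z e e ≈ √w e
  √Z-on-diagonal e with e ≟ e
  ... | yes _   = refl
  ... | no e≢e = ⊥-elim (e≢e ≡.refl)

  Lᵀ√Z-entry : ∀ i e → Lᵀ√Z i e ≈ L e i * √w e
  Lᵀ√Z-entry i e = trans (⊗-diagonalʳ (transpose L) √Z-diagonal i e) (*-congˡ (√Z-on-diagonal e))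

  √ZR-entry : ∀ e j → √ZR e j ≈ √w e * R e j
  √ZR-entry e j = trans (⊗-diagonalˡ R √Z-diagonal e j) (*-congʳ (√Z-on-diagonal e))

  edge-term : Fin n → Fin n → Fin m → Carrier
  edge-term i j e = L e i * (w e * R e j)

  edge-term-from-to : ∀ {e i j} → src e ≡ i → tgt e ≡ j → edge-term i j e ≈ A i j
  edge-term-from-to {e} {i} {j} p q = begin
    L e i * (w e * R e j)   ≈⟨ *-cong (L-at p) (*-cong (reflexive (≡.cong₂ A p q)) (R-at q)) ⟩
    1# * (A i j * 1#)       ≈⟨ *-identityˡ (A i j * 1#) ⟩
    A i j * 1#              ≈⟨ *-identityʳ (A i j) ⟩
    A i j ∎

  edge-term≈0 : ∀ {e i j} → (src e ≡ i → tgt e ≡ j → edge-term i j e ≈ 0#) →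
                edge-term i j e ≈ 0#
  edge-term≈0 {e} {i} {j} from-to≈0 with src e ≟ i | tgt e ≟ j
  ... | yes p | yes q = from-to≈0 p q
  ... | no _  | _     = zeroˡ _
  ... | yes _ | no _  = trans (*-congˡ (zeroʳ (w e))) (zeroʳ _)

  Σ-edge-term : ∀ i j → Σ (edge-term i j) ≈ A i j
  Σ-edge-term i j with nonneg i j
  ... | inj₁ Aij≈0 = trans (Σ-zero (edge-term i j) term≈0) (sym Aij≈0)
    where
    term≈0 : ∀ e → edge-term i j e ≈ 0#
    term≈0 e = edge-term≈0 (λ p q → trans (edge-term-from-to p q) Aij≈0)
  ... | inj₂ Aij>0 with surjective i j Aij>0
  ... | e₀ , p₀ , q₀ = trans (Σ-supported-at e₀ (edge-term i j) other≈0) (edge-term-from-to p₀ q₀)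
    where
    other≈0 : ∀ e → e ≢ e₀ → edge-term i j e ≈ 0#
    other≈0 e e≢e₀ = edge-term≈0 λ p q →
      ⊥-elim (e≢e₀ (injective e e₀ (≡.trans p (≡.sym p₀)) (≡.trans q (≡.sym q₀))))

  √W-entry : ∀ e f → sqrtᵉ W e f ≈ √w e * (L f (tgt e) * √w f)
  √W-entry e f with tgt e ≟ src f
  ... | yes p = begin
    sqrt (w e * w f)              ≈⟨ sqrt-* (edgePos e) (edgePos f) ⟩
    √w e * √w f                   ≈⟨ *-congˡ (*-identityˡ (√w f)) ⟨
    √w e * (1# * √w f)            ≈⟨ *-congˡ (*-congʳ (L-at (≡.sym p))) ⟨
    √w e * (L f (tgt e) * √w f)   ∎
  ... | no p = begin
    sqrt 0#                       ≈⟨ sqrt-0 ⟩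
    0#                            ≈⟨ zeroʳ (√w e) ⟨
    √w e * 0#                     ≈⟨ *-congˡ (zeroˡ (√w f)) ⟨
    √w e * (0# * √w f)            ≈⟨ *-congˡ (*-congʳ (L-off (p ∘ ≡.sym))) ⟨
    √w e * (L f (tgt e) * √w f)   ∎

  √ZR⊗Lᵀ√Z≈√W : (√ZR ⊗ Lᵀ√Z) ≈ᴹ sqrtᵉ W
  √ZR⊗Lᵀ√Z≈√W e f = begin
    Σ (λ j → √ZR e j * Lᵀ√Z j f)
      ≈⟨ Σ-cong (λ j → *-cong (√ZR-entry e j) (Lᵀ√Z-entry j f)) ⟩
    Σ (λ j → (√w e * R e j) * (L f j * √w f))
      ≈⟨ Σ-supported-at (tgt e) (λ j → (√w e * R e j) * (L f j * √w f))
           (λ j j≢tgt → trans (*-congʳ (trans (*-congˡ (R-off (j≢tgt ∘ ≡.sym))) (zeroʳ (√w e)))) (zeroˡ _)) ⟩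
    (√w e * R e (tgt e)) * (L f (tgt e) * √w f)
      ≈⟨ *-congʳ (trans (*-congˡ (R-at ≡.refl)) (*-identityʳ (√w e))) ⟩
    √w e * (L f (tgt e) * √w f)
      ≈⟨ √W-entry e f ⟨
    sqrtᵉ W e f ∎

  Lᵀ√Z⊗√ZR≈A : (Lᵀ√Z ⊗ √ZR) ≈ᴹ A
  Lᵀ√Z⊗√ZR≈A i j = begin
    Σ (λ e → Lᵀ√Z i e * √ZR e j)
      ≈⟨ Σ-cong (λ e → *-cong (Lᵀ√Z-entry i e) (√ZR-entry e j)) ⟩
    Σ (λ e → (L e i * √w e) * (√w e * R e j))
      ≈⟨ Σ-cong (λ e → regroup (L e i) (√w e) (R e j)) ⟩
    Σ (λ e → L e i * ((√w e * √w e) * R e j))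
      ≈⟨ Σ-cong (λ e → *-congˡ (*-congʳ (√w-sq e))) ⟩
    Σ (λ e → L e i * (w e * R e j))
      ≈⟨ Σ-edge-term i j ⟩
    A i j ∎
    where
    regroup : ∀ x y z → (x * y) * (y * z) ≈ x * ((y * y) * z)
    regroup x y z = trans (*-assoc x y (y * z)) (*-congˡ (sym (*-assoc y y z)))

corollary4p4 : ∀ {c ℓ : Level} (S : SqrtRing c ℓ) (n m : ℕ)
    (A : Mat.Matrix S n n) (src tgt : Fin m → Fin n) →
    Mat.IsEdgeLabelling S A src tgt →
    (k : ℕ) →
    let open Mat S
        open Graph A src tgt
    in (transpose L ⊗ (sqrtᵉ Z ⊗ ((sqrtᵉ W ^ k) ⊗ (sqrtᵉ Z ⊗ R)))) ≈ᴹ (A ^ suc k)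
corollary4p4 S n m A src tgt labelling k = begin
  transpose L ⊗ (sqrtᵉ Z ⊗ ((sqrtᵉ W ^ k) ⊗ √ZR))
    ≈⟨ ⊗-assoc (transpose L) (sqrtᵉ Z) ((sqrtᵉ W ^ k) ⊗ √ZR) ⟨
  Lᵀ√Z ⊗ ((sqrtᵉ W ^ k) ⊗ √ZR)
    ≈⟨ ⊗-congˡ (⊗-cong (^-cong √ZR⊗Lᵀ√Z≈√W k) ≈ᴹ-refl) ⟨
  Lᵀ√Z ⊗ (((√ZR ⊗ Lᵀ√Z) ^ k) ⊗ √ZR)
    ≈⟨ push-through-^ Lᵀ√Z √ZR Lᵀ√Z⊗√ZR≈A k ⟩
  A ^ suc k ∎
  where
  open Mat S
  open Graph A src tgt
  open MatrixAlgebra S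
  open LineGraphFactorisation S A src tgt labelling
  open ᴹ-Reasoning
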